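{- A tree $T$ that has a vertex $v$ with $\deg(v)\geq 4$, or has two distinct vertices $u,v$ with $\deg(u)\geq 3$ and $\deg(v)\geq 3$, is not in $\mathcal{G}^{\rm SSP}$.
   Context: All graphs are finite, simple and undirected. For a graph $G$ on vertex set $\{1,\dots,n\}$, $\mathcal{S}(G)$ denotes the set of real symmetric $n\times n$ matrices $A=[a_{ij}]$ such that for $i\neq j$, $a_{ij}\neq 0$ if and only if $\{i,j\}\in E(G)$ (diagonal entries unrestricted). A real symmetric matrix $A$ has the strong spectral property (SSP) if the only real symmetric matrix $X$ satisfying $A\circ X=0$, $I\circ X=0$ and $AX-XA=0$ is $X=0$ (entrywise product $\circ$). $\mathcal{G}^{\rm SSP}$ denotes the set of all graphs $G$ such that every matrix in $\mathcal{S}(G)$ has the SSP. -}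

module Defs where

open import Level using (Level; _⊔_) renaming (suc to lsuc)
open import Data.Nat using (ℕ; zero; suc; _≤_)
open import Data.Fin using (Fin)
open import Data.Bool using (Bool; true; false; if_then_else_)
open import Data.List using (List; []; _∷_; length; map; allFin; _∷ʳ_)
open import Data.Nat.ListAction using (sum)
open import Data.List.Relation.Unary.Unique.Propositional using (Unique)
open import Data.List.Relation.Unary.Linked using (Linked)
open import Data.Product using (Σ; ∃; _×_; _,_)
open import Relation.Nullary using (¬_)
open import Relation.Binary.PropositionalEquality using (_≡_)
open import Relation.Binary.Structures using (IsTotalOrder)
open import Algebra.Bundles using (CommutativeRing)

record Graph (n : ℕ) : Set where
  field
    adj     : Fin n → Fin n → Bool
    adj-sym : ∀ i j → adj i j ≡ adj j i
    irrefl  : ∀ i → adj i i ≡ false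

module _ {n : ℕ} (G : Graph n) where
  open Graph G

  Edge : Fin n → Fin n → Set
  Edge i j = adj i j ≡ true

  deg : Fin n → ℕ
  deg v = sum (map (λ j → if adj v j then 1 else 0) (allFin n))

  data Walk : Fin n → Fin n → Set where
    stay : ∀ {u} → Walk u u
    step : ∀ {u w v} → Edge u w → Walk w v → Walk u v

  Connected : Set
  Connected = ∀ u v → Walk u v

  HasCycle : Set
  HasCycle = Σ (Fin n) λ u → Σ (List (Fin n)) λ ws →
    (2 ≤ length ws) × Unique (u ∷ ws) × Linked Edge ((u ∷ ws) ∷ʳ u)

  IsTree : Set
  IsTree = Connected × ¬ HasCycle

record RealNumbers (c ℓ : Level) : Set (lsuc (c ⊔ ℓ)) where
  field
    commutativeRing : CommutativeRing c ℓ
  open CommutativeRing commutativeRing public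
  field
    _≤ᵣ_           : Carrier → Carrier → Set ℓ
    ≤-isTotalOrder : IsTotalOrder _≈_ _≤ᵣ_
    +-mono-≤       : ∀ {x y} z → x ≤ᵣ y → (x + z) ≤ᵣ (y + z)
    *-nonneg       : ∀ {x y} → 0# ≤ᵣ x → 0# ≤ᵣ y → 0# ≤ᵣ (x * y)
    0≉1            : ¬ (0# ≈ 1#)
    inverse        : ∀ x → ¬ (x ≈ 0#) → ∃ λ y → (x * y) ≈ 1#
    completeness   : (P : Carrier → Set (c ⊔ ℓ)) → ∃ P →
                     (∃ λ b → ∀ x → P x → x ≤ᵣ b) →
                     ∃ λ s → (∀ x → P x → x ≤ᵣ s) ×
                             (∀ b → (∀ x → P x → x ≤ᵣ b) → s ≤ᵣ b)

module _ {c ℓ : Level} (ℝ : RealNumbers c ℓ) where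
  open RealNumbers ℝ

  Matrix : ℕ → Set c
  Matrix n = Fin n → Fin n → Carrier

  sumF : ∀ {n} → (Fin n → Carrier) → Carrier
  sumF {zero}  f = 0#
  sumF {suc n} f = f Fin.zero + sumF (λ i → f (Fin.suc i))

  _·_ : ∀ {n} → Matrix n → Matrix n → Matrix n
  (A · B) i j = sumF (λ k → A i k * B k j)

  Symmetric : ∀ {n} → Matrix n → Set ℓ
  Symmetric A = ∀ i j → A i j ≈ A j i

  InS : ∀ {n} → Graph n → Matrix n → Set ℓ
  InS {n} G A = Symmetric A ×
    (∀ i j → ¬ (i ≡ j) → ((¬ (A i j ≈ 0#) → Edge G i j) × (Edge G i j → ¬ (A i j ≈ 0#))))

  SSP : ∀ {n} → Matrix n → Set (c ⊔ ℓ)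
  SSP {n} A = (X : Matrix n) → Symmetric X →
    (∀ i j → (A i j * X i j) ≈ 0#) →
    (∀ i → X i i ≈ 0#) →
    (∀ i j → (A · X) i j ≈ (X · A) i j) →
    ∀ i j → X i j ≈ 0#

  InGSSP : ∀ {n} → Graph n → Set (c ⊔ ℓ)
  InGSSP {n} G = (A : Matrix n) → InS G A → SSP A

module Submission where

-- Pick centres u, v (u = v in the first case) and two neighbours of each centre, such that
-- the four branches of T − {u, v} at these neighbours are pairwise disjoint and each meets
-- the centres only through the edge to its own centre.  Let L be the Laplacian of T whose
-- diagonal counts only non-centre neighbours; L ∈ S(T), and the indicator of a branch
-- hanging from the centre p is mapped by L to −e_p.  Hence the difference x of the two
-- indicators at u, and likewise y at v, are null vectors of L with disjoint supports, and
-- X = x yᵀ + y xᵀ is a nonzero symmetric matrix with L ∘ X = I ∘ X = 0 and LX = XL = 0.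
--
-- Membership in a branch is decided only up to double
-- negation, which suffices because the conclusion is negative.

open import Defs
open import Level using (Level)
open import Data.Nat using (ℕ; zero; suc; _≤_; z≤n; s≤s)
open import Data.Fin using (Fin; zero; suc)
open import Data.Fin.Properties using (_≟_)
open import Data.Bool using (Bool; true; false; if_then_else_)
open import Data.Product using (Σ; ∃; _×_; _,_; proj₁; proj₂)
open import Data.Sum using (_⊎_; inj₁; inj₂)
open import Data.Empty using (⊥; ⊥-elim)
open import Function using (_∘_)
open import Relation.Nullary using (¬_; Dec; yes; no; does)
open import Relation.Nullary.Decidable using (¬¬-excluded-middle)
import Relation.Binary.PropositionalEquality as P
open P using (_≡_; _≢_)

module Counting where
  open import Data.Nat using (_+_)
  open import Data.Nat.Properties using (+-assoc; +-comm; ≤-trans; <⇒≤)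
  open import Data.Bool using (_∧_; not)
  open import Data.Bool.Properties using (∧-identityʳ; ∧-zeroʳ)
  open import Data.List using (List; []; _∷_; length; map; tabulate)
  open import Data.List.Relation.Unary.All using (All; []; _∷_)
  open import Data.Nat.ListAction using (sum)
  open P using (refl; sym; trans; cong; cong₂; subst)

  bit : Bool → ℕ
  bit b = if b then 1 else 0

  count : ∀ {m} → (Fin m → Bool) → ℕ
  count {zero}  f = 0
  count {suc m} f = bit (f zero) + count (f ∘ suc)

  count-cong : ∀ {m} {f g : Fin m → Bool} → (∀ j → f j ≡ g j) → count f ≡ count g
  count-cong {zero}  f≗g = refl
  count-cong {suc m} f≗g = cong₂ _+_ (cong bit (f≗g zero)) (count-cong (f≗g ∘ suc))

  deg≡count : ∀ {m} (G : Graph m) v → deg G v ≡ count (Graph.adj G v)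
  deg≡count {m} G v = sum-tabulate (Graph.adj G v) (λ j → j)
    where
    sum-tabulate : ∀ {k} (f : Fin m → Bool) (h : Fin k → Fin m) →
                   sum (map (λ j → bit (f j)) (tabulate h)) ≡ count (f ∘ h)
    sum-tabulate {zero}  f h = refl
    sum-tabulate {suc k} f h = cong (bit (f (h zero)) +_) (sum-tabulate f (h ∘ suc))

  _∖_ : ∀ {m} → (Fin m → Bool) → Fin m → Fin m → Bool
  (f ∖ j) z = f z ∧ not (does (z ≟ j))

  ∖-true : ∀ {m} (f : Fin m → Bool) j z → (f ∖ j) z ≡ true → f z ≡ true × z ≢ j
  ∖-true f j z fz with f z | z ≟ j
  ... | true | no z≢j = refl , z≢j
  ∖-true f j z () | true  | yes _
  ∖-true f j z () | false | _

  count-∖ : ∀ {m} (f : Fin m → Bool) j → count f ≡ bit (f j) + count (f ∖ j)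
  count-∖ {suc m} f zero
    rewrite ∧-zeroʳ (f zero) = cong (bit (f zero) +_) (count-cong (λ z → sym (∧-identityʳ (f (suc z)))))
  count-∖ {suc m} f (suc j)
    rewrite ∧-identityʳ (f zero) | count-∖ (f ∘ suc) j =
      left-comm (bit (f zero)) (bit (f (suc j))) (count ((f ∘ suc) ∖ j))
    where
    left-comm : ∀ a b c → a + (b + c) ≡ b + (a + c)
    left-comm a b c = trans (sym (+-assoc a b c)) (trans (cong (_+ c) (+-comm a b)) (+-assoc b a c))

  count-∖-≥ : ∀ {m k} (f : Fin m → Bool) j → suc k ≤ count f → k ≤ count (f ∖ j)
  count-∖-≥ f j k<count = lower (f j) (subst (_ ≤_) (count-∖ f j) k<count)
    where
    lower : ∀ {k c} b → suc k ≤ bit b + c → k ≤ c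
    lower true  (s≤s k≤c) = k≤c
    lower false k<c       = <⇒≤ k<c

  witness : ∀ {m} (f : Fin m → Bool) → 1 ≤ count f → ∃ λ j → f j ≡ true
  witness {suc m} f pos with f zero in f0
  ... | true  = zero , f0
  ... | false = let j , fj = witness (f ∘ suc) pos in suc j , fj

  pairAvoiding : ∀ {m} (f : Fin m → Bool) (ws : List (Fin m)) → 2 + length ws ≤ count f →
                 Σ (Fin m) λ a → Σ (Fin m) λ b →
                 f a ≡ true × f b ≡ true × a ≢ b × All (a ≢_) ws × All (b ≢_) ws
  pairAvoiding f [] two≤count =
    let a , fa = witness f (≤-trans (s≤s z≤n) two≤count)
        b , fb∖a = witness (f ∖ a) (count-∖-≥ f a two≤count)
        fb , b≢a = ∖-true f a b fb∖a
    in a , b , fa , fb , P.≢-sym b≢a , [] , []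
  pairAvoiding f (w ∷ ws) bound =
    let a , b , fa∖w , fb∖w , a≢b , a∉ws , b∉ws = pairAvoiding (f ∖ w) ws (count-∖-≥ f w bound)
        fa , a≢w = ∖-true f w a fa∖w
        fb , b≢w = ∖-true f w b fb∖w
    in a , b , fa , fb , a≢b , a≢w ∷ a∉ws , b≢w ∷ b∉ws

module Walks {n : ℕ} (T : Graph n) where
  open Graph T
  open import Data.Unit using (⊤; tt)
  open import Data.List using (List; []; _∷_; length; _∷ʳ_)
  open import Data.List.Membership.Propositional using (_∈_; _∉_)
  open import Data.List.Relation.Unary.Any using (here; there; any?)
  open import Data.List.Relation.Unary.All using (All; []; _∷_) renaming (map to all-map)
  open import Data.List.Relation.Unary.All.Properties.Core using (¬Any⇒All¬)
  open import Data.List.Relation.Unary.AllPairs.Core using (AllPairs; []; _∷_)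
  open import Data.List.Relation.Unary.Linked using (Linked; [-]; _∷_)
  open P using (refl; sym; trans)

  edge-sym : ∀ {a b} → Edge T a b → Edge T b a
  edge-sym {a} {b} e = trans (adj-sym b a) e

  edge-≢ : ∀ {a b} → Edge T a b → a ≢ b
  edge-≢ {a} e refl with trans (sym e) (irrefl a)
  ... | ()

  data WalkIn (V : Fin n → Set) : Fin n → Fin n → Set where
    stop : ∀ {a} → V a → WalkIn V a a
    move : ∀ {a b c} → V a → Edge T a b → WalkIn V b c → WalkIn V a c

  module _ {V : Fin n → Set} where

    first-in : ∀ {a c} → WalkIn V a c → V a
    first-in (stop va)     = va
    first-in (move va _ _) = va

    last-in : ∀ {a c} → WalkIn V a c → V c
    last-in (stop vc)     = vc
    last-in (move _ _ w) = last-in w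

    extend : ∀ {a b c} → WalkIn V a b → Edge T b c → V c → WalkIn V a c
    extend (stop va)      e vc = move va e (stop vc)
    extend (move va e′ w) e vc = move va e′ (extend w e vc)

    reverse : ∀ {a c} → WalkIn V a c → WalkIn V c a
    reverse (stop va)     = stop va
    reverse (move va e w) = extend (reverse w) (edge-sym e) va

    _++_ : ∀ {a b c} → WalkIn V a b → WalkIn V b c → WalkIn V a c
    stop _     ++ w′ = w′
    move va e w ++ w′ = move va e (w ++ w′)

  weaken : ∀ {V V′ : Fin n → Set} → (∀ {z} → V z → V′ z) → ∀ {a c} → WalkIn V a c → WalkIn V′ a c
  weaken f (stop va)     = stop (f va)
  weaken f (move va e w) = move (f va) e (weaken f w)

  fromWalk : ∀ {a c} → Walk T a c → WalkIn (λ _ → ⊤) a c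
  fromWalk stay       = stop tt
  fromWalk (step e w) = move tt e (fromWalk w)

  data PathIn (V : Fin n → Set) : Fin n → Fin n → List (Fin n) → Set where
    stop : ∀ {a} → V a → PathIn V a a (a ∷ [])
    move : ∀ {a b c vs} → V a → Edge T a b → a ∉ vs → PathIn V b c vs → PathIn V a c (a ∷ vs)

  module _ {V : Fin n → Set} where

    suffix : ∀ {a b c vs} → PathIn V b c vs → a ∈ vs → ∃ (PathIn V a c)
    suffix p@(stop _)       (here refl) = _ , p
    suffix p@(move _ _ _ _) (here refl) = _ , p
    suffix (move _ _ _ p)   (there a∈vs) = suffix p a∈vs

    shortcut : ∀ {a c} → WalkIn V a c → ∃ (PathIn V a c)
    shortcut (stop va) = _ , stop va
    shortcut (move {a} va e w) with shortcut w
    ... | vs , p with any? (a ≟_) vs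
    ...   | yes a∈vs = suffix p a∈vs
    ...   | no  a∉vs = _ , move va e a∉vs p

    path-vertices : ∀ {a c vs} → PathIn V a c vs → All V vs
    path-vertices (stop va)       = va ∷ []
    path-vertices (move va _ _ p) = va ∷ path-vertices p

    path-unique : ∀ {a c vs} → PathIn V a c vs → AllPairs _≢_ vs
    path-unique (stop _)                  = [] ∷ []
    path-unique (move {vs = vs} _ _ a∉vs p) = ¬Any⇒All¬ vs a∉vs ∷ path-unique p

    path-linked : ∀ {a c d vs} → PathIn V a c vs → Edge T c d → Linked (Edge T) (vs ∷ʳ d)
    path-linked (stop _)                     e = e ∷ [-]
    path-linked (move _ e′ _ p@(stop _))       e = e′ ∷ path-linked p e
    path-linked (move _ e′ _ p@(move _ _ _ _)) e = e′ ∷ path-linked p e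

    path-nonempty : ∀ {a c vs} → PathIn V a c vs → 1 ≤ length vs
    path-nonempty (stop _)       = s≤s z≤n
    path-nonempty (move _ _ _ _) = s≤s z≤n

    toWalk : ∀ {V′ : Fin n → Set} {a c vs} → PathIn V a c vs → All V′ vs → WalkIn V′ a c
    toWalk (stop _)       (v ∷ []) = stop v
    toWalk (move _ e _ p) (v ∷ vs) = move v e (toWalk p vs)

  -- In an acyclic graph two distinct neighbours a, b of p cannot be joined
  -- avoiding p: such a walk, shortened to a path, closes a cycle through p.
  no-detour : ¬ HasCycle T → ∀ {p a b} → Edge T p a → Edge T p b → a ≢ b →
              ¬ WalkIn (_≢ p) a b
  no-detour acyclic {p} pa pb a≢b w with shortcut w
  ... | _ , stop _ = a≢b refl
  ... | _ , path@(move _ _ _ rest) =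
    acyclic (p , _ , s≤s (path-nonempty rest) ,
             all-map (λ z≢p p≡z → z≢p (sym p≡z)) (path-vertices path) ∷ path-unique path ,
             pa ∷ path-linked path (edge-sym pb))

  towards : ∀ {s t} → s ≢ t → Walk T s t → Σ (Fin n) λ w → Edge T s w × WalkIn (_≢ s) t w
  towards s≢t walk with shortcut (fromWalk walk)
  ... | _ , stop _ = ⊥-elim (s≢t refl)
  ... | _ , move {b = w} {vs = vs} _ e s∉vs rest =
    w , e , reverse (toWalk rest (all-map (λ z≢s s≡z → z≢s (sym s≡z)) (¬Any⇒All¬ vs s∉vs)))

-- A branch of G at a set of centres: a set S of non-centre vertices, closed
-- under edges between non-centres, and joined to the centres by the single
-- edge p–a (the hub p and the root a).
record Branch {n : ℕ} (G : Graph n) (centre : Fin n → Bool) (S : Fin n → Set) (p a : Fin n) : Set where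
  field
    hub-centre     : centre p ≡ true
    hub-edge       : Edge G p a
    root           : S a
    avoids-centres : ∀ {k} → S k → centre k ≡ false
    closed         : ∀ {k j} → S k → Edge G k j → centre j ≡ false → S j
    attached       : ∀ {k j} → centre k ≡ true → Edge G k j → S j → j ≡ a × k ≡ p

-- Branches of an acyclic graph T at centres p and q: for a neighbour a of p on a side
-- of T − p not containing q, the component of T − {p, q} containing a is a Branch.
module TreeBranches {n : ℕ} (T : Graph n) (acyclic : ¬ HasCycle T) where
  open Walks T
  open P using (refl; sym; trans; subst)

  Away : Fin n → Fin n → Fin n → Set
  Away p q a = ¬ WalkIn (_≢ p) a q

  away-from-itself : ∀ {p a} → Away p p a
  away-from-itself w = last-in w refl

  away-off-route : ∀ {p q w a} → Edge T p w → WalkIn (_≢ p) q w → Edge T p a → a ≢ w → Away p q a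
  away-off-route pw q⇝w pa a≢w a⇝q = no-detour acyclic pa pw a≢w (a⇝q ++ q⇝w)

  roots-apart : ∀ {p q a b} → q ≢ p → Edge T p a → Away p q a → Edge T q b → a ≢ b
  roots-apart q≢p pa away qb refl = away (move (edge-≢ pa ∘ sym) (edge-sym qb) (stop q≢p))

  record Fork (p q : Fin n) : Set where
    field
      left right       : Fin n
      left-edge        : Edge T p left
      right-edge       : Edge T p right
      distinct         : left ≢ right
      left-away        : Away p q left
      right-away       : Away p q right

  Apart : ∀ {p q p′ q′} → Fork p q → Fork p′ q′ → Set
  Apart f g = left f ≢ left g × left f ≢ right g × right f ≢ left g × right f ≢ right g
    where open Fork

  module Centres (centre : Fin n → Bool) where

    NonCentre : Fin n → Set
    NonCentre z = centre z ≡ false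

    Br : Fin n → Fin n → Set
    Br a k = WalkIn NonCentre k a

    module Around (p q : Fin n) (p-centre : centre p ≡ true) (q-centre : centre q ≡ true)
                  (only-p-q : ∀ {z} → centre z ≡ true → z ≡ p ⊎ z ≡ q) where

      noncentre-≢ : ∀ {c z} → centre c ≡ true → NonCentre z → z ≢ c
      noncentre-≢ c-centre z-non refl with trans (sym c-centre) z-non
      ... | ()

      noncentre : ∀ {z} → z ≢ p → z ≢ q → NonCentre z
      noncentre {z} z≢p z≢q with centre z in cz
      ... | false = refl
      ... | true with only-p-q cz
      ...   | inj₁ z≡p = ⊥-elim (z≢p z≡p)
      ...   | inj₂ z≡q = ⊥-elim (z≢q z≡q)

      avoid-p : ∀ {a b} → WalkIn NonCentre a b → WalkIn (_≢ p) a b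
      avoid-p = weaken (noncentre-≢ p-centre)

      joining : ∀ {a b k} → Br a k → Br b k → WalkIn (_≢ p) a b
      joining k⇝a k⇝b = avoid-p (reverse k⇝a ++ k⇝b)

      branch-root : ∀ {a} → Edge T p a → Away p q a → Br a a
      branch-root {a} pa away = stop (noncentre a≢p a≢q)
        where
        a≢p : a ≢ p
        a≢p = edge-≢ pa ∘ sym
        a≢q : a ≢ q
        a≢q a≡q = away (subst (WalkIn (_≢ p) a) a≡q (stop a≢p))

      branch-attached : ∀ {a k j} → Edge T p a → Away p q a → centre k ≡ true → Edge T k j →
                        Br a j → j ≡ a × k ≡ p
      branch-attached {a} {k} {j} pa away k-centre kj j⇝a with k ≟ p
      ... | yes refl with j ≟ a
      ...   | yes j≡a = j≡a , refl
      ...   | no  j≢a = ⊥-elim (no-detour acyclic kj pa j≢a (avoid-p j⇝a))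
      branch-attached {a} {k} {j} pa away k-centre kj j⇝a | no k≢p with only-p-q k-centre
      ...   | inj₁ k≡p = ⊥-elim (k≢p k≡p)
      ...   | inj₂ k≡q =
        ⊥-elim (away (subst (WalkIn (_≢ p) a) k≡q (extend (avoid-p (reverse j⇝a)) (edge-sym kj) k≢p)))

      branch : ∀ {a} → Edge T p a → Away p q a → Branch T centre (Br a) p a
      branch pa away = record
        { hub-centre     = p-centre
        ; hub-edge       = pa
        ; root           = branch-root pa away
        ; avoids-centres = first-in
        ; closed         = λ k⇝a kj j-non → move j-non (edge-sym kj) k⇝a
        ; attached       = branch-attached pa away
        }

      siblings-disjoint : ∀ {a b k} → Edge T p a → Edge T p b → a ≢ b → Br a k → Br b k → ⊥
      siblings-disjoint pa pb a≢b k⇝a k⇝b = no-detour acyclic pa pb a≢b (joining k⇝a k⇝b)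

      branches-disjoint : ∀ {a b k} → Edge T p a → Away p q a → Edge T q b → a ≢ b →
                          Br a k → Br b k → ⊥
      branches-disjoint pa away qb a≢b k⇝a k⇝b with q ≟ p
      ... | yes refl = siblings-disjoint pa qb a≢b k⇝a k⇝b
      ... | no q≢p   = away (extend (joining k⇝a k⇝b) (edge-sym qb) q≢p)

module LinearAlgebra {c ℓ : Level} (ℝ : RealNumbers c ℓ) where
  open RealNumbers ℝ hiding (zero)
  open import Algebra.Properties.Semiring.Sum semiring
    using (sum; sum-cong-≋; sum-replicate-zero; sum-remove; ∑-distrib-+; *-distribˡ-sum; *-distribʳ-sum)
  open import Algebra.Properties.Ring ring using (-1*x≈-x; -‿distribʳ-*)
  open import Data.Fin using (punchIn)
  open import Data.Fin.Properties using (punchInᵢ≢i)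
  open import Relation.Binary.Reasoning.Setoid setoid

  Vector : ℕ → Set c
  Vector n = Fin n → Carrier

  sumF≡sum : ∀ {m} (f : Vector m) → sumF ℝ f ≡ sum f
  sumF≡sum {zero}  f = P.refl
  sumF≡sum {suc m} f = P.cong (f zero +_) (sumF≡sum (f ∘ suc))

  sum-zero : ∀ {m} (f : Vector m) → (∀ k → f k ≈ 0#) → sum f ≈ 0#
  sum-zero {m} f f≈0 = trans (sum-cong-≋ f≈0) (sum-replicate-zero m)

  sum-supported : ∀ {m} (f : Vector m) a → (∀ k → k ≢ a → f k ≈ 0#) → sum f ≈ f a
  sum-supported {suc m} f a vanish = begin
    sum f                                 ≈⟨ sum-remove {i = a} f ⟩
    f a + sum (λ k → f (punchIn a k))     ≈⟨ +-congˡ (sum-zero _ (λ k → vanish _ (punchInᵢ≢i a k))) ⟩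
    f a + 0#                              ≈⟨ +-identityʳ (f a) ⟩
    f a                                   ∎

  sum-neg : ∀ {m} (f : Vector m) → sum (λ k → - f k) ≈ - sum f
  sum-neg f = begin
    sum (λ k → - f k)        ≈⟨ sum-cong-≋ (λ k → sym (-1*x≈-x (f k))) ⟩
    sum (λ k → - 1# * f k)   ≈⟨ sym (*-distribˡ-sum (- 1#) f) ⟩
    - 1# * sum f             ≈⟨ -1*x≈-x (sum f) ⟩
    - sum f                  ∎

  infixl 7 _·ᵥ_
  _·ᵥ_ : ∀ {n} → Matrix ℝ n → Vector n → Vector n
  (A ·ᵥ x) i = sum (λ k → A i k * x k)

  Null : ∀ {n} → Matrix ℝ n → Vector n → Set ℓ
  Null A x = ∀ i → (A ·ᵥ x) i ≈ 0#

  ·ᵥ-sub : ∀ {n} (A : Matrix ℝ n) (x y : Vector n) i →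
           (A ·ᵥ (λ k → x k - y k)) i ≈ (A ·ᵥ x) i - (A ·ᵥ y) i
  ·ᵥ-sub A x y i = begin
    sum (λ k → A i k * (x k - y k))
      ≈⟨ sum-cong-≋ (λ k → trans (distribˡ (A i k) (x k) (- y k)) (+-congˡ (sym (-‿distribʳ-* (A i k) (y k))))) ⟩
    sum (λ k → A i k * x k + - (A i k * y k))
      ≈⟨ ∑-distrib-+ (λ k → A i k * x k) (λ k → - (A i k * y k)) ⟩
    (A ·ᵥ x) i + sum (λ k → - (A i k * y k))
      ≈⟨ +-congˡ (sum-neg (λ k → A i k * y k)) ⟩
    (A ·ᵥ x) i - (A ·ᵥ y) i ∎

  rankTwo : ∀ {n} → Vector n → Vector n → Matrix ℝ n
  rankTwo x y i j = x i * y j + y i * x j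

  rankTwo-symmetric : ∀ {n} (x y : Vector n) → Symmetric ℝ (rankTwo x y)
  rankTwo-symmetric x y i j = trans (+-comm _ _) (+-cong (*-comm (y i) (x j)) (*-comm (x i) (y j)))

  rankTwo-annihilated : ∀ {n} (A : Matrix ℝ n) {x y : Vector n} → Null A x → Null A y →
                        ∀ i j → _·_ ℝ A (rankTwo x y) i j ≈ 0#
  rankTwo-annihilated A {x} {y} Ax≈0 Ay≈0 i j rewrite sumF≡sum (λ k → A i k * rankTwo x y k j) = begin
    sum (λ k → A i k * (x k * y j + y k * x j))
      ≈⟨ sum-cong-≋ (λ k → trans (distribˡ (A i k) (x k * y j) (y k * x j))
                                  (+-cong (sym (*-assoc (A i k) (x k) (y j))) (sym (*-assoc (A i k) (y k) (x j))))) ⟩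
    sum (λ k → A i k * x k * y j + A i k * y k * x j)
      ≈⟨ ∑-distrib-+ (λ k → A i k * x k * y j) (λ k → A i k * y k * x j) ⟩
    sum (λ k → A i k * x k * y j) + sum (λ k → A i k * y k * x j)
      ≈⟨ +-cong (sym (*-distribʳ-sum (y j) (λ k → A i k * x k))) (sym (*-distribʳ-sum (x j) (λ k → A i k * y k))) ⟩
    (A ·ᵥ x) i * y j + (A ·ᵥ y) i * x j
      ≈⟨ +-cong (*-congʳ (Ax≈0 i)) (*-congʳ (Ay≈0 i)) ⟩
    0# * y j + 0# * x j
      ≈⟨ +-cong (zeroˡ (y j)) (zeroˡ (x j)) ⟩
    0# + 0#
      ≈⟨ +-identityʳ 0# ⟩
    0# ∎

  -- for symmetric A the product the other way round is the transpose, hence also 0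
  rankTwo-commutes : ∀ {n} (A : Matrix ℝ n) {x y : Vector n} → Symmetric ℝ A → Null A x → Null A y →
                     ∀ i j → _·_ ℝ A (rankTwo x y) i j ≈ _·_ ℝ (rankTwo x y) A i j
  rankTwo-commutes {n} A {x} {y} symA Ax≈0 Ay≈0 i j = begin
    _·_ ℝ A X i j
      ≈⟨ rankTwo-annihilated A Ax≈0 Ay≈0 i j ⟩
    0#
      ≈⟨ sym (rankTwo-annihilated A Ax≈0 Ay≈0 j i) ⟩
    _·_ ℝ A X j i
      ≡⟨ sumF≡sum (λ k → A j k * X k i) ⟩
    sum (λ k → A j k * X k i)
      ≈⟨ sum-cong-≋ (λ k → trans (*-comm (A j k) (X k i)) (*-cong (rankTwo-symmetric x y k i) (symA j k))) ⟩
    sum (λ k → X i k * A k j)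
      ≡⟨ P.sym (sumF≡sum (λ k → X i k * A k j)) ⟩
    _·_ ℝ X A i j ∎
    where
    X : Matrix ℝ n
    X = rankTwo x y

  rankTwo-notSSP : ∀ {n} (A : Matrix ℝ n) {x y : Vector n} → Symmetric ℝ A → Null A x → Null A y →
                   (∀ i j → A i j * rankTwo x y i j ≈ 0#) → (∀ i → rankTwo x y i i ≈ 0#) →
                   ∀ a b → ¬ (rankTwo x y a b ≈ 0#) → ¬ SSP ℝ A
  rankTwo-notSSP A {x} {y} symA Ax≈0 Ay≈0 hadamard diagonal a b nonzero ssp =
    nonzero (ssp (rankTwo x y) (rankTwo-symmetric x y) hadamard diagonal
                 (rankTwo-commutes A symA Ax≈0 Ay≈0) a b)

¬¬-decidable : ∀ {m} (Q : Fin m → Set) → ¬ ¬ (∀ k → Dec (Q k))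
¬¬-decidable {zero}  Q no-decision = no-decision (λ ())
¬¬-decidable {suc m} Q no-decision =
  ¬¬-excluded-middle λ Q₀? → ¬¬-decidable (Q ∘ suc) λ Q₊? →
    no-decision λ { zero → Q₀? ; (suc k) → Q₊? k }

module CentredLaplacian {c ℓ : Level} (ℝ : RealNumbers c ℓ) {n : ℕ} (G : Graph n) (centre : Fin n → Bool) where
  open RealNumbers ℝ hiding (zero)
  open LinearAlgebra ℝ
  open Graph G
  open Walks G using (edge-sym)
  open import Algebra.Properties.Semiring.Sum semiring using (sum; sum-cong-≋; ∑-distrib-+; *-distribʳ-sum)
  open import Algebra.Properties.Ring ring using (-0#≈0#; -‿involutive; -1*x≈-x)
  open import Relation.Binary.Reasoning.Setoid setoid
  open import Relation.Unary using (_∪_) renaming (_⊥_ to Disjoint)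

  weight : Fin n → Carrier
  weight j = if centre j then 0# else 1#

  neighbourWeight : Fin n → Fin n → Carrier
  neighbourWeight i j = if adj i j then weight j else 0#

  L : Matrix ℝ n
  L i j = if does (i ≟ j) then sum (neighbourWeight i) else (if adj i j then - 1# else 0#)

  L-symmetric : Symmetric ℝ L
  L-symmetric i j with i ≟ j | j ≟ i
  ... | yes P.refl | yes _      = refl
  ... | yes P.refl | no j≢j     = ⊥-elim (j≢j P.refl)
  ... | no i≢i     | yes P.refl = ⊥-elim (i≢i P.refl)
  ... | no _       | no _       rewrite adj-sym i j = refl

  -1≉0 : ¬ (- 1# ≈ 0#)
  -1≉0 -1≈0 = 0≉1 (sym (trans (sym (-‿involutive 1#)) (trans (-‿cong -1≈0) -0#≈0#)))

  -- L ∈ S(G): off the diagonal it is −1 exactly on the edges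
  L∈S : InS ℝ G L
  L∈S = L-symmetric , off-diagonal
    where
    off-diagonal : ∀ i j → i ≢ j → (¬ (L i j ≈ 0#) → Edge G i j) × (Edge G i j → ¬ (L i j ≈ 0#))
    off-diagonal i j i≢j with i ≟ j
    ... | yes i≡j = ⊥-elim (i≢j i≡j)
    ... | no _ with adj i j
    ...   | true  = (λ _ → P.refl) , (λ _ → -1≉0)
    ...   | false = (λ L≉0 → ⊥-elim (L≉0 refl)) , (λ ())

  L-hadamard : (X : Matrix ℝ n) → (∀ i → X i i ≈ 0#) → (∀ i j → Edge G i j → X i j ≈ 0#) →
               ∀ i j → L i j * X i j ≈ 0#
  L-hadamard X diagonal edges i j with i ≟ j
  ... | yes P.refl = trans (*-congˡ (diagonal i)) (zeroʳ _)
  ... | no _ with adj i j in e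
  ...   | true  = trans (*-congˡ (edges i j e)) (zeroʳ _)
  ...   | false = zeroˡ _

  edgeTerm : Vector n → Fin n → Fin n → Carrier
  edgeTerm x i j = if adj i j then weight j * x i - x j else 0#

  L-action : ∀ x i → (L ·ᵥ x) i ≈ sum (edgeTerm x i)
  L-action x i = begin
    sum (λ k → L i k * x k)                ≈⟨ sum-cong-≋ split ⟩
    sum (λ k → D k + F k)                  ≈⟨ ∑-distrib-+ D F ⟩
    sum D + sum F                          ≈⟨ +-congʳ (trans (sum-supported D i diagonal-only) (diagonal-at (i ≟ i))) ⟩
    sum (neighbourWeight i) * x i + sum F  ≈⟨ +-congʳ (*-distribʳ-sum (x i) (neighbourWeight i)) ⟩
    sum (λ j → neighbourWeight i j * x i) + sum F
                                           ≈⟨ sym (∑-distrib-+ (λ j → neighbourWeight i j * x i) F) ⟩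
    sum (λ j → neighbourWeight i j * x i + F j) ≈⟨ sum-cong-≋ combine ⟩
    sum (edgeTerm x i)                     ∎
    where
    D F : Vector n
    D k = if does (i ≟ k) then sum (neighbourWeight i) * x i else 0#
    F k = if adj i k then - x k else 0#

    split : ∀ k → L i k * x k ≈ D k + F k
    split k with i ≟ k
    split k | yes P.refl rewrite irrefl i = sym (+-identityʳ _)
    split k | no _ with adj i k
    ... | true  = trans (-1*x≈-x (x k)) (sym (+-identityˡ _))
    ... | false = trans (zeroˡ (x k)) (sym (+-identityˡ _))

    diagonal-only : ∀ k → k ≢ i → D k ≈ 0#
    diagonal-only k k≢i with i ≟ k
    ... | yes i≡k = ⊥-elim (k≢i (P.sym i≡k))
    ... | no _    = refl

    diagonal-at : (d : Dec (i ≡ i)) →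
                  (if does d then sum (neighbourWeight i) * x i else 0#) ≈ sum (neighbourWeight i) * x i
    diagonal-at (yes _)  = refl
    diagonal-at (no i≢i) = ⊥-elim (i≢i P.refl)

    combine : ∀ j → neighbourWeight i j * x i + F j ≈ edgeTerm x i j
    combine j with adj i j
    ... | true  = refl
    ... | false = trans (+-identityʳ _) (zeroˡ (x i))

  -- a branch S hanging from the hub p: its indicator vector is mapped by L to −e_p
  module BranchIndicator {S : Fin n → Set} {p a : Fin n} (branch : Branch G centre S p a)
                         (S? : ∀ k → Dec (S k)) where
    open Branch branch

    indicator : Vector n
    indicator k = if does (S? k) then 1# else 0#

    indicator-outside : ∀ {k} → ¬ S k → indicator k ≡ 0#
    indicator-outside {k} k∉S with S? k
    ... | yes k∈S = ⊥-elim (k∉S k∈S)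
    ... | no _    = P.refl

    indicator-inside : ∀ {k} → S k → indicator k ≡ 1#
    indicator-inside {k} k∈S with S? k
    ... | yes _   = P.refl
    ... | no k∉S  = ⊥-elim (k∉S k∈S)

    centre-outside : ∀ {k} → centre k ≡ true → ¬ S k
    centre-outside k-centre k∈S with P.trans (P.sym k-centre) (avoids-centres k∈S)
    ... | ()

    indicator-centre : ∀ {k} → centre k ≡ true → indicator k ≡ 0#
    indicator-centre k-centre = indicator-outside (centre-outside k-centre)

    indicator-edge : ∀ {i j} → Edge G i j → centre i ≡ false → centre j ≡ false → indicator i ≡ indicator j
    indicator-edge {i} {j} ij i-non j-non with S? i | S? j
    ... | yes _   | yes _   = P.refl
    ... | no _    | no _    = P.refl
    ... | yes i∈S | no j∉S  = ⊥-elim (j∉S (closed i∈S ij j-non))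
    ... | no i∉S  | yes j∈S = ⊥-elim (i∉S (closed j∈S (edge-sym ij) i-non))

    row-noncentre : ∀ {i} → centre i ≡ false → (L ·ᵥ indicator) i ≈ 0#
    row-noncentre {i} i-non = trans (L-action indicator i) (sum-zero _ cancels)
      where
      cancels : ∀ j → edgeTerm indicator i j ≈ 0#
      cancels j with adj i j in ij
      ... | false = refl
      ... | true with centre j in j-centre
      ...   | true  = trans (+-cong (zeroˡ _) (-‿cong (reflexive (indicator-centre j-centre))))
                            (trans (+-identityˡ _) -0#≈0#)
      ...   | false = trans (+-cong (*-identityˡ _) (-‿cong (reflexive (P.sym (indicator-edge ij i-non j-centre)))))
                            (-‿inverseʳ _)

    row-centre : ∀ {i} → centre i ≡ true → (L ·ᵥ indicator) i ≈ sum (λ j → if adj i j then - indicator j else 0#)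
    row-centre {i} i-centre = trans (L-action indicator i) (sum-cong-≋ term)
      where
      term : ∀ j → edgeTerm indicator i j ≈ (if adj i j then - indicator j else 0#)
      term j with adj i j
      ... | false = refl
      ... | true  = trans (+-congʳ (trans (*-congˡ (reflexive (indicator-centre i-centre))) (zeroʳ _)))
                          (+-identityˡ _)

    -- the hub row picks up −1 from the root a
    row-hub : (L ·ᵥ indicator) p ≈ - 1#
    row-hub = trans (row-centre hub-centre) (trans (sum-supported _ a only-root) at-root)
      where
      only-root : ∀ j → j ≢ a → (if adj p j then - indicator j else 0#) ≈ 0#
      only-root j j≢a with adj p j in pj
      ... | false = refl
      ... | true  = trans (-‿cong (reflexive (indicator-outside λ j∈S → j≢a (proj₁ (attached hub-centre pj j∈S)))))
                          -0#≈0#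
      at-root : (if adj p a then - indicator a else 0#) ≈ - 1#
      at-root rewrite hub-edge with S? a
      ... | yes _   = refl
      ... | no a∉S  = ⊥-elim (a∉S root)

    row-other : ∀ {i} → i ≢ p → (L ·ᵥ indicator) i ≈ 0#
    row-other {i} i≢p with centre i in i-centre
    ... | false = row-noncentre i-centre
    ... | true  = trans (row-centre i-centre) (sum-zero _ no-edge-into-S)
      where
      no-edge-into-S : ∀ j → (if adj i j then - indicator j else 0#) ≈ 0#
      no-edge-into-S j with adj i j in ij
      ... | false = refl
      ... | true  = trans (-‿cong (reflexive (indicator-outside λ j∈S → i≢p (proj₂ (attached i-centre ij j∈S)))))
                          -0#≈0#

  module BranchPair {S S′ : Fin n → Set} {p a a′ : Fin n}
                    (branch : Branch G centre S p a) (branch′ : Branch G centre S′ p a′)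
                    (S? : ∀ k → Dec (S k)) (S′? : ∀ k → Dec (S′ k)) where
    private
      module I  = BranchIndicator branch S?
      module I′ = BranchIndicator branch′ S′?

    difference : Vector n
    difference k = I.indicator k - I′.indicator k

    difference-null : Null L difference
    difference-null i = trans (·ᵥ-sub L I.indicator I′.indicator i) (cancel (i ≟ p))
      where
      cancel : Dec (i ≡ p) → (L ·ᵥ I.indicator) i - (L ·ᵥ I′.indicator) i ≈ 0#
      cancel (yes P.refl) = trans (+-congʳ I.row-hub) (trans (+-congˡ (-‿cong I′.row-hub)) (-‿inverseʳ _))
      cancel (no i≢p)     = trans (+-cong (I.row-other i≢p) (-‿cong (I′.row-other i≢p)))
                                  (trans (+-identityˡ _) -0#≈0#)

    difference-outside : ∀ {k} → ¬ S k → ¬ S′ k → difference k ≈ 0#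
    difference-outside k∉S k∉S′ =
      trans (+-cong (reflexive (I.indicator-outside k∉S)) (-‿cong (reflexive (I′.indicator-outside k∉S′))))
            (trans (+-identityˡ _) -0#≈0#)

    difference-root : ¬ S′ a → difference a ≈ 1#
    difference-root a∉S′ =
      trans (+-cong (reflexive (I.indicator-inside (Branch.root branch)))
                    (-‿cong (reflexive (I′.indicator-outside a∉S′))))
            (trans (+-congˡ -0#≈0#) (+-identityʳ 1#))

    difference-centre : ∀ {k} → centre k ≡ true → difference k ≈ 0#
    difference-centre k-centre = difference-outside (I.centre-outside k-centre) (I′.centre-outside k-centre)

    difference-edge : ∀ {i j} → Edge G i j → centre i ≡ false → centre j ≡ false → difference i ≡ difference j
    difference-edge ij i-non j-non =
      P.cong₂ _-_ (I.indicator-edge ij i-non j-non) (I′.indicator-edge ij i-non j-non)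

  module FourBranches {S₁ S₂ S₃ S₄ : Fin n → Set} {p q a₁ a₂ a₃ a₄ : Fin n}
           (b₁ : Branch G centre S₁ p a₁) (b₂ : Branch G centre S₂ p a₂)
           (b₃ : Branch G centre S₃ q a₃) (b₄ : Branch G centre S₄ q a₄)
           (S₁? : ∀ k → Dec (S₁ k)) (S₂? : ∀ k → Dec (S₂ k))
           (S₃? : ∀ k → Dec (S₃ k)) (S₄? : ∀ k → Dec (S₄ k))
           (disjoint₁₂ : Disjoint S₁ S₂) (disjoint₃₄ : Disjoint S₃ S₄) (disjoint : Disjoint (S₁ ∪ S₂) (S₃ ∪ S₄)) where
    private
      module X = BranchPair b₁ b₂ S₁? S₂?
      module Y = BranchPair b₃ b₄ S₃? S₄?

    x y : Vector n
    x = X.difference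
    y = Y.difference

    Z : Matrix ℝ n
    Z = rankTwo x y

    y-vanishes : ∀ {i} → (S₁ ∪ S₂) i → y i ≈ 0#
    y-vanishes i∈x = Y.difference-outside (λ i∈S₃ → disjoint (i∈x , inj₁ i∈S₃))
                                          (λ i∈S₄ → disjoint (i∈x , inj₂ i∈S₄))

    supports-disjoint : ∀ i → x i * y i ≈ 0#
    supports-disjoint i = by-cases (S₁? i) (S₂? i)
      where
      by-cases : Dec (S₁ i) → Dec (S₂ i) → x i * y i ≈ 0#
      by-cases (yes i∈S₁) _          = trans (*-congˡ (y-vanishes (inj₁ i∈S₁))) (zeroʳ _)
      by-cases (no _)     (yes i∈S₂) = trans (*-congˡ (y-vanishes (inj₂ i∈S₂))) (zeroʳ _)
      by-cases (no i∉S₁)  (no i∉S₂)  = trans (*-congʳ (X.difference-outside i∉S₁ i∉S₂)) (zeroˡ _)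

    Z-diagonal : ∀ i → Z i i ≈ 0#
    Z-diagonal i = trans (+-cong (supports-disjoint i) (trans (*-comm (y i) (x i)) (supports-disjoint i)))
                         (+-identityʳ 0#)

    -- Z vanishes on edges: x and y vanish at centres and are constant along other edges
    Z-edges : ∀ i j → Edge G i j → Z i j ≈ 0#
    Z-edges i j ij with centre i in i-centre | centre j in j-centre
    ... | true  | _     = trans (+-cong (trans (*-congʳ (X.difference-centre i-centre)) (zeroˡ _))
                                        (trans (*-congʳ (Y.difference-centre i-centre)) (zeroˡ _)))
                                (+-identityʳ 0#)
    ... | false | true  = trans (+-cong (trans (*-congˡ (Y.difference-centre j-centre)) (zeroʳ _))
                                        (trans (*-congˡ (X.difference-centre j-centre)) (zeroʳ _)))
                                (+-identityʳ 0#)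
    ... | false | false = trans (reflexive (P.cong₂ (λ x′ y′ → x i * y′ + y i * x′)
                                                  (P.sym (X.difference-edge ij i-centre j-centre))
                                                  (P.sym (Y.difference-edge ij i-centre j-centre))))
                                (Z-diagonal i)

    Z-root : Z a₁ a₃ ≈ 1#
    Z-root = begin
      x a₁ * y a₃ + y a₁ * x a₃  ≈⟨ +-cong (*-cong (X.difference-root a₁∉S₂) (Y.difference-root a₃∉S₄))
                                           (*-cong y-a₁ x-a₃) ⟩
      1# * 1# + 0# * 0#          ≈⟨ +-cong (*-identityˡ 1#) (zeroˡ 0#) ⟩
      1# + 0#                    ≈⟨ +-identityʳ 1# ⟩
      1#                         ∎
      where
      a₁∈ : S₁ a₁
      a₁∈ = Branch.root b₁
      a₃∈ : S₃ a₃
      a₃∈ = Branch.root b₃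
      a₁∉S₂ : ¬ S₂ a₁
      a₁∉S₂ a₁∈S₂ = disjoint₁₂ (a₁∈ , a₁∈S₂)
      a₃∉S₄ : ¬ S₄ a₃
      a₃∉S₄ a₃∈S₄ = disjoint₃₄ (a₃∈ , a₃∈S₄)
      y-a₁ : y a₁ ≈ 0#
      y-a₁ = y-vanishes (inj₁ a₁∈)
      x-a₃ : x a₃ ≈ 0#
      x-a₃ = X.difference-outside (λ a₃∈S₁ → disjoint (inj₁ a₃∈S₁ , inj₁ a₃∈))
                                  (λ a₃∈S₂ → disjoint (inj₂ a₃∈S₂ , inj₁ a₃∈))

    notGSSP : ¬ InGSSP ℝ G
    notGSSP inGSSP =
      rankTwo-notSSP L L-symmetric X.difference-null Y.difference-null
        (L-hadamard Z Z-diagonal Z-edges) Z-diagonal a₁ a₃ (λ Z≈0 → 0≉1 (trans (sym Z≈0) Z-root))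
        (inGSSP L L∈S)

  -- the conclusion is negative, so the four branches may be assumed decidable
  branches-notGSSP : ∀ {S₁ S₂ S₃ S₄ : Fin n → Set} {p q a₁ a₂ a₃ a₄ : Fin n} →
    Branch G centre S₁ p a₁ → Branch G centre S₂ p a₂ → Branch G centre S₃ q a₃ → Branch G centre S₄ q a₄ →
    Disjoint S₁ S₂ → Disjoint S₃ S₄ → Disjoint (S₁ ∪ S₂) (S₃ ∪ S₄) → ¬ InGSSP ℝ G
  branches-notGSSP {S₁} {S₂} {S₃} {S₄} b₁ b₂ b₃ b₄ d₁₂ d₃₄ d inGSSP =
    ¬¬-decidable S₁ λ S₁? → ¬¬-decidable S₂ λ S₂? → ¬¬-decidable S₃ λ S₃? → ¬¬-decidable S₄ λ S₄? →
    FourBranches.notGSSP b₁ b₂ b₃ b₄ S₁? S₂? S₃? S₄? d₁₂ d₃₄ d inGSSP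

module TwoCentres {n : ℕ} (u v : Fin n) where
  open import Data.Bool using (_∨_)

  centres : Fin n → Bool
  centres z = does (z ≟ u) ∨ does (z ≟ v)

  u-centre : centres u ≡ true
  u-centre with u ≟ u
  ... | yes _   = P.refl
  ... | no u≢u  = ⊥-elim (u≢u P.refl)

  v-centre : centres v ≡ true
  v-centre with v ≟ u | v ≟ v
  ... | yes _ | _       = P.refl
  ... | no _  | yes _   = P.refl
  ... | no _  | no v≢v  = ⊥-elim (v≢v P.refl)

  only-u-v : ∀ {z} → centres z ≡ true → z ≡ u ⊎ z ≡ v
  only-u-v {z} z-centre with z ≟ u | z ≟ v
  ... | yes z≡u | _       = inj₁ z≡u
  ... | no _    | yes z≡v = inj₂ z≡v
  only-u-v {z} () | no _ | no _

module Trees {c ℓ : Level} (ℝ : RealNumbers c ℓ) {n : ℕ} (T : Graph n) (acyclic : ¬ HasCycle T) where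
  open TreeBranches T acyclic
  open Counting using (pairAvoiding; deg≡count)
  open Walks T using (towards)
  open import Data.Nat.Properties using (≤-trans)
  open import Data.Nat using (_+_)
  open import Data.List using (List; []; _∷_; length)
  open import Data.List.Relation.Unary.All using (All; []; _∷_)
  open import Data.Sum using (swap)
  open P using (≢-sym)

  forks-notGSSP : ∀ {u v} (f : Fork u v) (g : Fork v u) → Apart f g → ¬ InGSSP ℝ T
  forks-notGSSP {u} {v} f g (l≢l , l≢r , r≢l , r≢r) =
    CentredLaplacian.branches-notGSSP ℝ T centres
      (U.branch (left-edge f) (left-away f)) (U.branch (right-edge f) (right-away f))
      (V.branch (left-edge g) (left-away g)) (V.branch (right-edge g) (right-away g))
      (λ (k⇝a , k⇝b) → U.siblings-disjoint (left-edge f) (right-edge f) (distinct f) k⇝a k⇝b)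
      (λ (k⇝a , k⇝b) → V.siblings-disjoint (left-edge g) (right-edge g) (distinct g) k⇝a k⇝b)
      across
    where
    open Fork
    open TwoCentres u v
    open Centres centres
    module U = Around u v u-centre v-centre only-u-v
    module V = Around v u v-centre u-centre (swap ∘ only-u-v)

    across : ∀ {k} → (Br (left f) k ⊎ Br (right f) k) × (Br (left g) k ⊎ Br (right g) k) → ⊥
    across (inj₁ k⇝a , inj₁ k⇝b) = U.branches-disjoint (left-edge f) (left-away f) (left-edge g) l≢l k⇝a k⇝b
    across (inj₁ k⇝a , inj₂ k⇝b) = U.branches-disjoint (left-edge f) (left-away f) (right-edge g) l≢r k⇝a k⇝b
    across (inj₂ k⇝a , inj₁ k⇝b) = U.branches-disjoint (right-edge f) (right-away f) (left-edge g) r≢l k⇝a k⇝b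
    across (inj₂ k⇝a , inj₂ k⇝b) = U.branches-disjoint (right-edge f) (right-away f) (right-edge g) r≢r k⇝a k⇝b

  forkAvoiding : ∀ {p q} (ws : List (Fin n)) → 2 + length ws ≤ deg T p →
                 (∀ {a} → Edge T p a → All (a ≢_) ws → Away p q a) →
                 Σ (Fork p q) λ f → All (Fork.left f ≢_) ws × All (Fork.right f ≢_) ws
  forkAvoiding {p} ws enough away
    with pairAvoiding (Graph.adj T p) ws (P.subst (_ ≤_) (deg≡count T p) enough)
  ... | a , b , pa , pb , a≢b , a∉ws , b∉ws =
    record { left = a ; right = b ; left-edge = pa ; right-edge = pb ; distinct = a≢b
           ; left-away = away pa a∉ws ; right-away = away pb b∉ws } ,
    a∉ws , b∉ws

  -- a vertex u of degree ≥ 4: both forks sit at u, with four distinct roots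
  hub-of-degree-four : ∀ {u} → 4 ≤ deg T u → ¬ InGSSP ℝ T
  hub-of-degree-four four≤deg
    with forkAvoiding [] (≤-trans (s≤s (s≤s z≤n)) four≤deg) (λ _ _ → away-from-itself)
  ... | f , _ with forkAvoiding (Fork.left f ∷ Fork.right f ∷ []) four≤deg (λ _ _ → away-from-itself)
  ...   | g , (lg≢lf ∷ lg≢rf ∷ []) , (rg≢lf ∷ rg≢rf ∷ []) =
    forks-notGSSP f g (≢-sym lg≢lf , ≢-sym rg≢lf , ≢-sym lg≢rf , ≢-sym rg≢rf)

  -- distinct vertices u, v of degree ≥ 3: the fork at u avoids the neighbour
  -- through which u reaches v, and vice versa
  two-hubs-of-degree-three : ∀ {u v} → u ≢ v → Walk T u v → Walk T v u →
                             3 ≤ deg T u → 3 ≤ deg T v → ¬ InGSSP ℝ T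
  two-hubs-of-degree-three {u} {v} u≢v u⇝v v⇝u three≤deg-u three≤deg-v
    with towards u≢v u⇝v | towards (u≢v ∘ P.sym) v⇝u
  ... | w , uw , v⇝w | w′ , vw′ , u⇝w′
    with forkAvoiding (w ∷ []) three≤deg-u (λ { ua (a≢w ∷ []) → away-off-route uw v⇝w ua a≢w })
       | forkAvoiding (w′ ∷ []) three≤deg-v (λ { vb (b≢w′ ∷ []) → away-off-route vw′ u⇝w′ vb b≢w′ })
  ...   | f , _ | g , _ =
    forks-notGSSP f g (apart (left-edge f) (left-away f) (left-edge g) ,
                       apart (left-edge f) (left-away f) (right-edge g) ,
                       apart (right-edge f) (right-away f) (left-edge g) ,
                       apart (right-edge f) (right-away f) (right-edge g))
    where
    open Fork
    apart : ∀ {a b} → Edge T u a → Away u v a → Edge T v b → a ≢ b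
    apart = roots-apart (u≢v ∘ P.sym)

corollary2p8 : {c ℓ : Level} (ℝ : RealNumbers c ℓ) (n : ℕ) (T : Graph n) →
    IsTree T →
    ((Σ (Fin n) λ v → 4 ≤ deg T v) ⊎
     (Σ (Fin n) λ u → Σ (Fin n) λ v → ¬ (u ≡ v) × 3 ≤ deg T u × 3 ≤ deg T v)) →
    ¬ InGSSP ℝ T
corollary2p8 ℝ _ T (_ , acyclic) (inj₁ (_ , four≤deg)) =
  Trees.hub-of-degree-four ℝ T acyclic four≤deg
corollary2p8 ℝ _ T (connected , acyclic) (inj₂ (u , v , u≢v , three≤deg-u , three≤deg-v)) =
  Trees.two-hubs-of-degree-three ℝ T acyclic u≢v (connected u v) (connected v u) three≤deg-u three≤deg-v
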